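{- Let $G$ be a finite connected undirected graph with a 2-edge-colouring $c:E(G)\to\{1,2\}$. Then all pivots of $G$ lie in the same $\mathscr S$-free component of $G$.
   Context: A walk is a sequence of vertices with consecutive vertices adjacent (vertices and edges may repeat); its length is its number of edges; it is closed if it starts and ends at the same vertex. A walk is properly coloured if no two consecutive edges of it have the same colour. A vertex $u$ is a pivot if there is a properly coloured closed walk of odd length starting and ending at $u$ (its first and last edges then have the same colour; the requirement concerns only consecutive edges along the walk). An edge is stubborn if it belongs to every closed walk of odd length in $G$; $\mathscr S$ is the set of stubborn edges. An $\mathscr S$-free component is the vertex set of a connected component of $G\setminus\mathscr S$. -}

module Defs where

open import Data.Nat using (ℕ; zero; suc; _%_)
open import Data.Fin using (Fin)
open import Data.Bool using (Bool; true; false)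
open import Data.Unit using (⊤)
open import Data.Empty using (⊥)
open import Data.Product using (_×_; Σ; ∃-syntax)
open import Data.Sum using (_⊎_)
open import Relation.Binary.PropositionalEquality using (_≡_; _≢_)
open import Relation.Nullary using (¬_)

record Graph (n : ℕ) : Set where
  field
    adj     : Fin n → Fin n → Bool
    adj-sym : ∀ u v → adj u v ≡ adj v u
    adj-irr : ∀ u → adj u u ≡ false

module _ {n : ℕ} (G : Graph n) where
  open Graph G

  -- An edge colouring with two colours (Fin 2 = {1,2}); it must be symmetric,
  -- values on non-edges are irrelevant.
  record Colouring : Set where
    field
      col     : Fin n → Fin n → Fin 2
      col-sym : ∀ u v → col u v ≡ col v u

  data Walk : Fin n → Fin n → Set where
    []   : ∀ {u} → Walk u u
    step : ∀ {u w} (v : Fin n) → adj u v ≡ true → Walk v w → Walk u w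

  length : ∀ {u w} → Walk u w → ℕ
  length []           = zero
  length (step _ _ W) = suc (length W)

  Connected : Set
  Connected = ∀ u v → Walk u v

  EdgeIn : Fin n → Fin n → ∀ {u w} → Walk u w → Set
  EdgeIn x y []               = ⊥
  EdgeIn x y (step {u} v _ W) = ((u ≡ x × v ≡ y) ⊎ (u ≡ y × v ≡ x)) ⊎ EdgeIn x y W

  OddLength : ∀ {u w} → Walk u w → Set
  OddLength W = length W % 2 ≡ 1

  Stubborn : Fin n → Fin n → Set
  Stubborn x y = adj x y ≡ true × (∀ u (W : Walk u u) → OddLength W → EdgeIn x y W)

  AvoidsStubborn : ∀ {u w} → Walk u w → Set
  AvoidsStubborn []               = ⊤
  AvoidsStubborn (step {u} v _ W) = ¬ Stubborn u v × AvoidsStubborn W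

  SameSFreeComponent : Fin n → Fin n → Set
  SameSFreeComponent u v = Σ (Walk u v) AvoidsStubborn

  module _ (c : Colouring) where
    open Colouring c

    ProperlyColoured : ∀ {u w} → Walk u w → Set
    ProperlyColoured []                              = ⊤
    ProperlyColoured (step v _ [])                   = ⊤
    ProperlyColoured (step {u} v _ (step x e W)) =
      col u v ≢ col v x × ProperlyColoured (step x e W)

    Pivot : Fin n → Set
    Pivot u = Σ (Walk u u) (λ W → OddLength W × ProperlyColoured W)

-- A stubborn edge xy lies on every odd closed walk, so closed walks avoiding xy are even.
-- Substituting a walk from x to y that avoids xy for each traversal of xy in a closed walk
-- shows: once some closed walk is odd, no such bypass is odd; and if one is even, every
-- closed walk has an even number of steps off xy.  The colours along a properly 2-coloured
-- walk alternate, so between two traversals of xy it would contain an odd walk joining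
-- endpoints of xy and avoiding xy: an odd properly coloured closed walk traverses xy exactly
-- once.  Cutting the walks at two pivots u, v there, every walk P from u to v has a number of
-- steps off xy of parity c(u) + c(v), where c is the colour of the first edge of the pivot's
-- walk; this does not depend on the stubborn edge.  If v were outside the 𝒮-free component
-- of u, the walk at v would enter that component through a stubborn edge f and later leave
-- it through a stubborn edge g; a walk from u to the exit point of g inside the component,
-- followed by the rest of the walk at v, traverses g once and f never, contradicting this
-- independence.  Membership in a component is decidable by breadth-first search, so the
-- contradiction yields a walk.

module Submission where

open import Defs
open import Level using (Level; _⊔_; 0ℓ)
open import Data.Bool using (true)
import Data.Bool.Properties as Bool
open import Data.Empty using (⊥)
open import Data.Unit using (tt)
open import Data.Nat using (ℕ; zero; suc; _+_; _*_; _%_; _≤_; _<_; z≤n; s≤s; parity)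
open import Data.Nat.Properties
  using (+-suc; +-comm; +-assoc; m≤m+n; m≤n+m; ≤-trans; ≤-reflexive; ≤-pred; +-monoʳ-≤; ≤-antisym;
         n≤0⇒n≡0; m+n≡0⇒m≡0; m+n≡0⇒n≡0; ≮⇒≥; n≢0⇒n>0; +-commutativeSemigroup; module ≤-Reasoning)
open import Data.Parity.Base using (Parity; 0ℙ; 1ℙ; _⁻¹) renaming (_+_ to _⊕_; _*_ to _⊛_)
import Data.Parity.Properties as ℙ
import Algebra.Properties.CommutativeSemigroup as CommutativeSemigroupProperties
open CommutativeSemigroupProperties ℙ.+-commutativeSemigroup using (interchange; xy∙z≈y∙xz)
open import Algebra.Properties.Group ℙ.+-0-group using (x∙y⁻¹≈ε⇒x≈y)
open CommutativeSemigroupProperties +-commutativeSemigroup using () renaming (x∙yz≈y∙xz to +-swapˡ)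
open import Data.Fin using (Fin) renaming (zero to 0F; suc to sucF)
open import Data.Fin.Properties using (_≟_; any?; *↔×)
open import Data.Fin.Subset using (Subset; _∈_; _∉_; _⊂_; _∪_; ⁅_⁆; ⊤; ∣_∣)
open import Data.Fin.Subset.Properties
  using (_∈?_; ∈⊤; x∈⁅x⁆; x∈⁅y⁆⇒x≡y; p⊆p∪q; q⊆p∪q; x∈p∪q⁻; p⊂q⇒∣p∣<∣q∣; ∣p∣≤n; ∣p∣≡n⇒p≡⊤)
open import Data.Product using (Σ; ∃; ∃₂; _×_; _,_; proj₁; proj₂)
open import Data.Sum using (_⊎_; inj₁; inj₂) renaming (swap to ⊎-swap)
open import Function.Base using (_∘_)
open import Function.Bundles using (Inverse; _↔_; mk↔ₛ′)
open import Function.Properties.Inverse using (↔-refl; ↔-sym; ↔-trans)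
open import Data.Product.Function.NonDependent.Propositional using (_×-↔_)
open import Relation.Binary.Core using (Rel)
open import Relation.Binary.Definitions using (Decidable)
open import Relation.Binary.Construct.Closure.ReflexiveTransitive using (Star; ε; _◅_; _◅◅_)
open import Relation.Nullary using (¬_; Dec; yes; no; ¬?; contradiction)
open import Relation.Nullary.Decidable using (_×-dec_; _⊎-dec_; map′; decidable-stable)
open import Relation.Unary using (Pred) renaming (Decidable to Decidable₁)
open import Relation.Binary.PropositionalEquality

module FiniteReachability {a ℓ : Level} {A : Set a} {k : ℕ} (enum : A ↔ Fin k)
                          {R : Rel A ℓ} (R? : Decidable R) (s : A) where
  open Inverse enum using (to; from; strictlyInverseʳ)

  Sound : Subset k → Set (a ⊔ ℓ)
  Sound V = ∀ {i} → i ∈ V → Star R s (from i)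

  Closed : Subset k → Set (a ⊔ ℓ)
  Closed V = ∀ {b c} → to b ∈ V → R b c → to c ∈ V

  Exit : Subset k → Set ℓ
  Exit V = ∃₂ λ i j → i ∈ V × j ∉ V × R (from i) (from j)

  exit? : ∀ V → Dec (Exit V)
  exit? V = any? λ i → any? λ j → i ∈? V ×-dec ¬? (j ∈? V) ×-dec R? (from i) (from j)

  closed-without-exit : ∀ {V} → ¬ Exit V → Closed V
  closed-without-exit {V} noExit {b} {c} b∈V bRc with to c ∈? V
  ... | yes c∈V = c∈V
  ... | no  c∉V = contradiction (to b , to c , b∈V , c∉V , subst₂ R (sym (strictlyInverseʳ b)) (sym (strictlyInverseʳ c)) bRc) noExit

  sound-∪-exit : ∀ {V i j} → Sound V → i ∈ V → R (from i) (from j) → Sound (V ∪ ⁅ j ⁆)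
  sound-∪-exit {V} {i} {j} sound i∈V r {i′} i′∈V′ with x∈p∪q⁻ V ⁅ j ⁆ i′∈V′
  ... | inj₁ i′∈V = sound i′∈V
  ... | inj₂ i′∈⁅j⁆ = subst (λ l → Star R s (from l)) (sym (x∈⁅y⁆⇒x≡y j i′∈⁅j⁆)) (sound i∈V ◅◅ (r ◅ ε))

  record Closure : Set (a ⊔ ℓ) where
    field
      V      : Subset k
      source : to s ∈ V
      sound  : Sound V
      closed : Closed V

  -- Each round adds a new index to V, so k rounds suffice.
  grow : (fuel : ℕ) (V : Subset k) → to s ∈ V → Sound V → k ≤ fuel + ∣ V ∣ → Closure
  grow zero V s∈V sound k≤∣V∣ = record
    { V = V ; source = s∈V ; sound = sound ; closed = λ _ _ → subst (_ ∈_) (sym V≡⊤) ∈⊤ }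
    where
    V≡⊤ : V ≡ ⊤
    V≡⊤ = ∣p∣≡n⇒p≡⊤ (≤-antisym (∣p∣≤n V) k≤∣V∣)
  grow (suc fuel) V s∈V sound k≤ with exit? V
  ... | no noExit = record { V = V ; source = s∈V ; sound = sound ; closed = closed-without-exit noExit }
  ... | yes (i , j , i∈V , j∉V , r) =
    grow fuel (V ∪ ⁅ j ⁆) (p⊆p∪q ⁅ j ⁆ s∈V) (sound-∪-exit sound i∈V r) (≤-trans k≤ (begin
      suc fuel + ∣ V ∣       ≡⟨ +-suc fuel ∣ V ∣ ⟨
      fuel + suc ∣ V ∣       ≤⟨ +-monoʳ-≤ fuel (p⊂q⇒∣p∣<∣q∣ V⊂V′) ⟩
      fuel + ∣ V ∪ ⁅ j ⁆ ∣   ∎))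
    where
    open ≤-Reasoning
    V⊂V′ : V ⊂ V ∪ ⁅ j ⁆
    V⊂V′ = ((λ {_} → p⊆p∪q ⁅ j ⁆) , j , q⊆p∪q V ⁅ j ⁆ (x∈⁅x⁆ j) , j∉V)

  closure : Closure
  closure = grow k ⁅ to s ⁆ (x∈⁅x⁆ (to s)) sound₀ (m≤m+n k _)
    where
    sound₀ : Sound ⁅ to s ⁆
    sound₀ i∈ = subst (λ l → Star R s (from l)) (sym (x∈⁅y⁆⇒x≡y (to s) i∈)) (subst (Star R s) (sym (strictlyInverseʳ s)) ε)

  closed-under-Star : ∀ {V} → Closed V → ∀ {b c} → to b ∈ V → Star R b c → to c ∈ V
  closed-under-Star closed b∈V ε          = b∈V
  closed-under-Star closed b∈V (r ◅ rest) = closed-under-Star closed (closed b∈V r) rest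

  star? : ∀ t → Dec (Star R s t)
  star? t = map′ (subst (Star R s) (strictlyInverseʳ t) ∘ sound) (closed-under-Star closed source) (to t ∈? V)
    where open Closure closure

%2≡1⇒parity≡1ℙ : ∀ m → m % 2 ≡ 1 → parity m ≡ 1ℙ
%2≡1⇒parity≡1ℙ (suc zero)    _ = refl
%2≡1⇒parity≡1ℙ (suc (suc m))   = %2≡1⇒parity≡1ℙ m

parity≡1ℙ⇒%2≡1 : ∀ m → parity m ≡ 1ℙ → m % 2 ≡ 1
parity≡1ℙ⇒%2≡1 (suc zero)    _ = refl
parity≡1ℙ⇒%2≡1 (suc (suc m))   = parity≡1ℙ⇒%2≡1 m

SameEdge : ∀ {n} → Fin n → Fin n → Fin n → Fin n → Set
SameEdge x y u v = (u ≡ x × v ≡ y) ⊎ (u ≡ y × v ≡ x)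

sameEdge? : ∀ {n} (x y u v : Fin n) → Dec (SameEdge x y u v)
sameEdge? x y u v = (u ≟ x ×-dec v ≟ y) ⊎-dec (u ≟ y ×-dec v ≟ x)

SameEdge-reverse : ∀ {n} {x y u v : Fin n} → SameEdge x y u v → SameEdge x y v u
SameEdge-reverse (inj₁ (u≡x , v≡y)) = inj₂ (v≡y , u≡x)
SameEdge-reverse (inj₂ (u≡y , v≡x)) = inj₁ (v≡x , u≡y)

traversal : ∀ {n} (x y u v : Fin n) → ℕ
traversal x y u v with sameEdge? x y u v
... | yes _ = 1
... | no  _ = 0

traversal-≡1 : ∀ {n} {x y u v : Fin n} → SameEdge x y u v → traversal x y u v ≡ 1
traversal-≡1 {x = x} {y} {u} {v} e with sameEdge? x y u v
... | yes _ = refl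
... | no ¬e = contradiction e ¬e

traversal-≡0 : ∀ {n} {x y u v : Fin n} → ¬ SameEdge x y u v → traversal x y u v ≡ 0
traversal-≡0 {x = x} {y} {u} {v} ¬e with sameEdge? x y u v
... | yes e = contradiction e ¬e
... | no  _ = refl

traversal-reverse : ∀ {n} (x y u v : Fin n) → traversal x y u v ≡ traversal x y v u
traversal-reverse x y u v with sameEdge? x y v u
... | yes e = traversal-≡1 (SameEdge-reverse e)
... | no ¬e = traversal-≡0 (¬e ∘ SameEdge-reverse)

module Walks {n : ℕ} (G : Graph n) where
  open Graph G

  adj-reverse : ∀ {u v} → adj u v ≡ true → adj v u ≡ true
  adj-reverse {u} {v} uv = trans (adj-sym v u) uv

  infixr 5 _++_
  _++_ : ∀ {s t r} → Walk G s t → Walk G t r → Walk G s r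
  []           ++ W′ = W′
  step v uv W ++ W′ = step v uv (W ++ W′)

  ++-assoc : ∀ {s t r q} (A : Walk G s t) (B : Walk G t r) (C : Walk G r q) → (A ++ B) ++ C ≡ A ++ (B ++ C)
  ++-assoc []           B C = refl
  ++-assoc (step v uv A) B C = cong (step v uv) (++-assoc A B C)

  length-++ : ∀ {s t r} (A : Walk G s t) (B : Walk G t r) → length G (A ++ B) ≡ length G A + length G B
  length-++ []           B = refl
  length-++ (step v uv A) B = cong suc (length-++ A B)

  reverse : ∀ {s t} → Walk G s t → Walk G t s
  reverse []                = []
  reverse (step {u} v uv W) = reverse W ++ step u (adj-reverse uv) []

  length-reverse : ∀ {s t} (W : Walk G s t) → length G (reverse W) ≡ length G W
  length-reverse []           = refl
  length-reverse (step v uv W) = begin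
    length G (reverse W ++ step _ _ [])   ≡⟨ length-++ (reverse W) _ ⟩
    length G (reverse W) + 1              ≡⟨ +-comm _ 1 ⟩
    suc (length G (reverse W))            ≡⟨ cong suc (length-reverse W) ⟩
    suc (length G W)                      ∎
    where open ≡-Reasoning

  traversals : ∀ {s t} (x y : Fin n) → Walk G s t → ℕ
  traversals x y []                = 0
  traversals x y (step {u} v _ W) = traversal x y u v + traversals x y W

  traversals-++ : ∀ {s t r} x y (A : Walk G s t) (B : Walk G t r) →
                  traversals x y (A ++ B) ≡ traversals x y A + traversals x y B
  traversals-++ x y []                B = refl
  traversals-++ x y (step {u} v uv A) B =
    trans (cong (traversal x y u v +_) (traversals-++ x y A B)) (sym (+-assoc (traversal x y u v) _ _))

  traversals-reverse : ∀ {s t} x y (W : Walk G s t) → traversals x y (reverse W) ≡ traversals x y W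
  traversals-reverse x y []                = refl
  traversals-reverse x y (step {u} v uv W) = begin
    traversals x y (reverse W ++ step u _ [])            ≡⟨ traversals-++ x y (reverse W) _ ⟩
    traversals x y (reverse W) + (traversal x y v u + 0) ≡⟨ cong₂ _+_ (traversals-reverse x y W) (+-comm _ 0) ⟩
    traversals x y W + traversal x y v u                 ≡⟨ +-comm _ (traversal x y v u) ⟩
    traversal x y v u + traversals x y W                 ≡⟨ cong (_+ traversals x y W) (traversal-reverse x y u v) ⟨
    traversal x y u v + traversals x y W                 ∎
    where open ≡-Reasoning

  EdgeIn⇒traversals>0 : ∀ {s t} x y (W : Walk G s t) → EdgeIn G x y W → 0 < traversals x y W
  EdgeIn⇒traversals>0 x y (step {u} v uv W) (inj₁ e) rewrite traversal-≡1 e = s≤s z≤n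
  EdgeIn⇒traversals>0 x y (step {u} v uv W) (inj₂ e) =
    ≤-trans (EdgeIn⇒traversals>0 x y W e) (m≤n+m _ (traversal x y u v))

  traversals>0⇒EdgeIn : ∀ {s t} x y (W : Walk G s t) → 0 < traversals x y W → EdgeIn G x y W
  traversals>0⇒EdgeIn x y (step {u} v uv W) pos with sameEdge? x y u v
  ... | yes e = inj₁ e
  ... | no  _ = inj₂ (traversals>0⇒EdgeIn x y W pos)

  record FirstTraversal (x y : Fin n) {s t} (W : Walk G s t) : Set where
    constructor firstTraversal
    field
      {u v}         : Fin n
      before        : Walk G s u
      edge          : adj u v ≡ true
      after         : Walk G v t
      same          : SameEdge x y u v
      before-avoids : traversals x y before ≡ 0
      decomposition : W ≡ before ++ step v edge after

  first-traversal : ∀ {s t} x y (W : Walk G s t) → 0 < traversals x y W → FirstTraversal x y W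
  first-traversal x y (step {u} v uv W) pos with sameEdge? x y u v
  ... | yes e  = firstTraversal [] uv W e refl refl
  ... | no  ¬e with first-traversal x y W pos
  ...   | firstTraversal A e′ B same A-avoids refl =
          firstTraversal (step v uv A) e′ B same (trans (cong (_+ traversals x y A) (traversal-≡0 ¬e)) A-avoids) refl

  traversals≤1⇒avoids-around : ∀ {s t u v} x y (A : Walk G s u) {uv : adj u v ≡ true} (B : Walk G v t) →
    SameEdge x y u v → traversals x y (A ++ step v uv B) ≤ 1 → traversals x y A ≡ 0 × traversals x y B ≡ 0
  traversals≤1⇒avoids-around {u = u} {v} x y A B e ≤1 = m+n≡0⇒m≡0 _ sum≡0 , m+n≡0⇒n≡0 (traversals x y A) sum≡0
    where
    sum≡0 : traversals x y A + traversals x y B ≡ 0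
    sum≡0 = n≤0⇒n≡0 (≤-pred (subst (_≤ 1) (begin
      traversals x y (A ++ step v _ B)                          ≡⟨ traversals-++ x y A _ ⟩
      traversals x y A + (traversal x y u v + traversals x y B) ≡⟨ cong (λ k → traversals x y A + (k + traversals x y B)) (traversal-≡1 e) ⟩
      traversals x y A + suc (traversals x y B)                 ≡⟨ +-suc _ _ ⟩
      suc (traversals x y A + traversals x y B)                 ∎) ≤1))
      where open ≡-Reasoning

  record Crossing {p} (P : Pred (Fin n) p) {s t} (W : Walk G s t) : Set p where
    constructor mkCrossing
    field
      {a b}         : Fin n
      before        : Walk G s a
      edge          : adj a b ≡ true
      after         : Walk G b t
      inside        : P a
      outside       : ¬ P b
      decomposition : W ≡ before ++ step b edge after

  crossing : ∀ {p} {P : Pred (Fin n) p} → Decidable₁ P → ∀ {s t} → P s → ¬ P t → (W : Walk G s t) → Crossing P W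
  crossing P? Ps ¬Pt []            = contradiction Ps ¬Pt
  crossing P? Ps ¬Pt (step v uv W) with P? v
  ... | no  ¬Pv = mkCrossing [] uv W Ps ¬Pv refl
  ... | yes Pv with crossing P? Pv ¬Pt W
  ...   | mkCrossing A ab B Pa ¬Pb refl = mkCrossing (step v uv A) ab B Pa ¬Pb refl

  EdgeIn⇒split : ∀ {s t} x y (W : Walk G s t) → EdgeIn G x y W →
                 ∃₂ λ (W₁ : Walk G s x) (W₂ : Walk G x t) → W ≡ W₁ ++ W₂
  EdgeIn⇒split x y (step v uv W) (inj₁ (inj₁ (refl , _))) = [] , step v uv W , refl
  EdgeIn⇒split x y (step v uv W) (inj₁ (inj₂ (_ , refl))) = step v uv [] , W , refl
  EdgeIn⇒split x y (step v uv W) (inj₂ e) with EdgeIn⇒split x y W e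
  ... | W₁ , W₂ , refl = step v uv W₁ , W₂ , refl

  EdgeIn-swap : ∀ {s t} x y (W : Walk G s t) → EdgeIn G x y W → EdgeIn G y x W
  EdgeIn-swap x y (step v uv W) (inj₁ e) = inj₁ (⊎-swap e)
  EdgeIn-swap x y (step v uv W) (inj₂ e) = inj₂ (EdgeIn-swap x y W e)

  -- The parity of the number of steps of W not along xy (in ℤ/2, subtracting is adding).
  offEdgeParity : ∀ {s t} (x y : Fin n) → Walk G s t → Parity
  offEdgeParity x y W = parity (length G W) ⊕ parity (traversals x y W)

  offEdgeParity-++ : ∀ {s t r} x y (A : Walk G s t) (B : Walk G t r) →
                     offEdgeParity x y (A ++ B) ≡ offEdgeParity x y A ⊕ offEdgeParity x y B
  offEdgeParity-++ x y A B = begin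
    parity (length G (A ++ B)) ⊕ parity (traversals x y (A ++ B))
      ≡⟨ cong₂ (λ l k → parity l ⊕ parity k) (length-++ A B) (traversals-++ x y A B) ⟩
    parity (length G A + length G B) ⊕ parity (traversals x y A + traversals x y B)
      ≡⟨ cong₂ _⊕_ (ℙ.+-homo-+ (length G A) _) (ℙ.+-homo-+ (traversals x y A) _) ⟩
    (parity (length G A) ⊕ parity (length G B)) ⊕ (parity (traversals x y A) ⊕ parity (traversals x y B))
      ≡⟨ interchange (parity (length G A)) _ _ _ ⟩
    offEdgeParity x y A ⊕ offEdgeParity x y B ∎
    where open ≡-Reasoning

  offEdgeParity-reverse : ∀ {s t} x y (W : Walk G s t) → offEdgeParity x y (reverse W) ≡ offEdgeParity x y W
  offEdgeParity-reverse x y W =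
    cong₂ (λ l k → parity l ⊕ parity k) (length-reverse W) (traversals-reverse x y W)

  AvoidsStubborn-++ : ∀ {s t r} (A : Walk G s t) (B : Walk G t r) →
                      AvoidsStubborn G A → AvoidsStubborn G B → AvoidsStubborn G (A ++ B)
  AvoidsStubborn-++ []            B _            avB = avB
  AvoidsStubborn-++ (step v uv A) B (¬st , avA) avB = ¬st , AvoidsStubborn-++ A B avA avB

  Stubborn-SameEdge : ∀ {x y u v} → Stubborn G x y → SameEdge x y u v → Stubborn G u v
  Stubborn-SameEdge st                (inj₁ (refl , refl)) = st
  Stubborn-SameEdge {x} {y} (xy , st) (inj₂ (refl , refl)) =
    adj-reverse xy , λ w W odd → EdgeIn-swap x y W (st w W odd)

  AvoidsStubborn⇒traversals≡0 : ∀ {x y s t} → Stubborn G x y → (W : Walk G s t) → AvoidsStubborn G W → traversals x y W ≡ 0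
  AvoidsStubborn⇒traversals≡0 st []                _           = refl
  AvoidsStubborn⇒traversals≡0 {x} {y} st (step {u} v uv W) (¬st , av) with sameEdge? x y u v
  ... | yes e = contradiction (Stubborn-SameEdge st e) ¬st
  ... | no  _ = AvoidsStubborn⇒traversals≡0 st W av

module StubbornEdge {n : ℕ} {G : Graph n} {x y : Fin n} (stubborn : Stubborn G x y) where
  open Graph G
  open Walks G

  avoiding-closed-walk-even : ∀ {s} (Y : Walk G s s) → traversals x y Y ≡ 0 → parity (length G Y) ≡ 0ℙ
  avoiding-closed-walk-even {s} Y avoids with parity (length G Y) in eq
  ... | 0ℙ = refl
  ... | 1ℙ = contradiction (subst (0 <_) avoids (EdgeIn⇒traversals>0 x y Y (proj₂ stubborn s Y (parity≡1ℙ⇒%2≡1 (length G Y) eq)))) λ ()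

  Bypass : Parity → Set
  Bypass p = Σ (Walk G x y) λ E → traversals x y E ≡ 0 × parity (length G E) ≡ p

  module Detour (E : Walk G x y) (E-avoids : traversals x y E ≡ 0) where

    bypass : ∀ {u v} → SameEdge x y u v → Walk G u v
    bypass (inj₁ (refl , refl)) = E
    bypass (inj₂ (refl , refl)) = reverse E

    length-bypass : ∀ {u v} (e : SameEdge x y u v) → length G (bypass e) ≡ length G E
    length-bypass (inj₁ (refl , refl)) = refl
    length-bypass (inj₂ (refl , refl)) = length-reverse E

    bypass-avoids : ∀ {u v} (e : SameEdge x y u v) → traversals x y (bypass e) ≡ 0
    bypass-avoids (inj₁ (refl , refl)) = E-avoids
    bypass-avoids (inj₂ (refl , refl)) = trans (traversals-reverse x y E) E-avoids

    detour : ∀ {s t} → Walk G s t → Walk G s t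
    detour []                = []
    detour (step {u} v uv W) with sameEdge? x y u v
    ... | yes e = bypass e ++ detour W
    ... | no  _ = step v uv (detour W)

    detour-avoids : ∀ {s t} (W : Walk G s t) → traversals x y (detour W) ≡ 0
    detour-avoids []                = refl
    detour-avoids (step {u} v uv W) with sameEdge? x y u v
    ... | yes e  = trans (traversals-++ x y (bypass e) _) (cong₂ _+_ (bypass-avoids e) (detour-avoids W))
    ... | no  ¬e = trans (cong (_+ _) (traversal-≡0 ¬e)) (detour-avoids W)

    length-detour : ∀ {s t} (W : Walk G s t) →
                    length G (detour W) + traversals x y W ≡ length G W + traversals x y W * length G E
    length-detour []                = refl
    length-detour (step {u} v uv W) with sameEdge? x y u v
    ... | no  _ = cong suc (length-detour W)
    ... | yes e = begin
      length G (bypass e ++ detour W) + suc t  ≡⟨ cong (_+ suc t) (trans (length-++ (bypass e) _) (cong (_+ lD) (length-bypass e))) ⟩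
      (lE + lD) + suc t                        ≡⟨ +-suc (lE + lD) t ⟩
      suc ((lE + lD) + t)                      ≡⟨ cong suc (+-assoc lE lD t) ⟩
      suc (lE + (lD + t))                      ≡⟨ cong (λ k → suc (lE + k)) (length-detour W) ⟩
      suc (lE + (length G W + t * lE))         ≡⟨ cong suc (+-swapˡ lE (length G W) (t * lE)) ⟩
      suc (length G W + (lE + t * lE))         ∎
      where
      open ≡-Reasoning
      t lE lD : ℕ
      t  = traversals x y W
      lE = length G E
      lD = length G (detour W)

    parity-detour : ∀ {s t} (W : Walk G s t) →
      parity (length G (detour W)) ⊕ parity (traversals x y W) ≡ parity (length G W) ⊕ (parity (traversals x y W) ⊛ parity (length G E))
    parity-detour W = begin
      parity (length G (detour W)) ⊕ parity (traversals x y W)  ≡⟨ ℙ.+-homo-+ (length G (detour W)) _ ⟨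
      parity (length G (detour W) + traversals x y W)           ≡⟨ cong parity (length-detour W) ⟩
      parity (length G W + traversals x y W * length G E)       ≡⟨ ℙ.+-homo-+ (length G W) _ ⟩
      parity (length G W) ⊕ parity (traversals x y W * length G E) ≡⟨ cong (parity (length G W) ⊕_) (ℙ.*-homo-* (traversals x y W) _) ⟩
      parity (length G W) ⊕ (parity (traversals x y W) ⊛ parity (length G E)) ∎
      where open ≡-Reasoning

    parity-closed-detour : ∀ {s} (Y : Walk G s s) →
      parity (traversals x y Y) ≡ parity (length G Y) ⊕ (parity (traversals x y Y) ⊛ parity (length G E))
    parity-closed-detour Y =
      trans (cong (_⊕ parity (traversals x y Y)) (sym (avoiding-closed-walk-even (detour Y) (detour-avoids Y)))) (parity-detour Y)

  -- Replacing each traversal of xy by an odd bypass keeps a closed walk odd but makes it avoid xy.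
  no-odd-bypass : ∀ {s} (Y : Walk G s s) → parity (length G Y) ≡ 1ℙ → ¬ Bypass 1ℙ
  no-odd-bypass Y Y-odd (E , E-avoids , E-odd) = contradiction (trans (sym Y-odd) Y-even) λ ()
    where
    open Detour E E-avoids
    l t : Parity
    l = parity (length G Y)
    t = parity (traversals x y Y)
    Y-even : l ≡ 0ℙ
    Y-even = ℙ.+-cancelʳ-≡ t l 0ℙ (sym (begin
      t                              ≡⟨ parity-closed-detour Y ⟩
      l ⊕ (t ⊛ parity (length G E))  ≡⟨ cong (λ p → l ⊕ (t ⊛ p)) E-odd ⟩
      l ⊕ (t ⊛ 1ℙ)                   ≡⟨ cong (l ⊕_) (ℙ.*-identityʳ t) ⟩
      l ⊕ t                          ∎))
      where open ≡-Reasoning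

  -- With an even bypass, the detour of a closed walk shows that its length and its number
  -- of traversals of xy have the same parity.
  offEdgeParity-closed : Bypass 0ℙ → ∀ {s} (Y : Walk G s s) → offEdgeParity x y Y ≡ 0ℙ
  offEdgeParity-closed (E , E-avoids , E-even) Y = trans (cong (_⊕ t) (sym t≡l)) (ℙ.p+p≡0ℙ t)
    where
    open Detour E E-avoids
    l t : Parity
    l = parity (length G Y)
    t = parity (traversals x y Y)
    t≡l : t ≡ l
    t≡l = begin
      t                              ≡⟨ parity-closed-detour Y ⟩
      l ⊕ (t ⊛ parity (length G E))  ≡⟨ cong (λ p → l ⊕ (t ⊛ p)) E-even ⟩
      l ⊕ (t ⊛ 0ℙ)                   ≡⟨ cong (l ⊕_) (ℙ.*-zeroʳ t) ⟩
      l ⊕ 0ℙ                         ≡⟨ ℙ.+-identityʳ l ⟩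
      l                              ∎
      where open ≡-Reasoning

  Endpoint : Fin n → Set
  Endpoint a = a ≡ x ⊎ a ≡ y

  source-Endpoint : ∀ {u v} → SameEdge x y u v → Endpoint u
  source-Endpoint (inj₁ (u≡x , _)) = inj₁ u≡x
  source-Endpoint (inj₂ (u≡y , _)) = inj₂ u≡y

  target-Endpoint : ∀ {u v} → SameEdge x y u v → Endpoint v
  target-Endpoint (inj₁ (_ , v≡y)) = inj₂ v≡y
  target-Endpoint (inj₂ (_ , v≡x)) = inj₁ v≡x

  no-odd-avoiding-walk-between-endpoints :
    ∀ {s} (Y : Walk G s s) → parity (length G Y) ≡ 1ℙ →
    ∀ {a b} → Endpoint a → Endpoint b → (C : Walk G a b) → traversals x y C ≡ 0 → parity (length G C) ≡ 1ℙ → ⊥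
  no-odd-avoiding-walk-between-endpoints Y Y-odd (inj₁ refl) (inj₂ refl) C C-avoids C-odd =
    no-odd-bypass Y Y-odd (C , C-avoids , C-odd)
  no-odd-avoiding-walk-between-endpoints Y Y-odd (inj₂ refl) (inj₁ refl) C C-avoids C-odd =
    no-odd-bypass Y Y-odd (reverse C , trans (traversals-reverse x y C) C-avoids , trans (cong parity (length-reverse C)) C-odd)
  no-odd-avoiding-walk-between-endpoints Y Y-odd (inj₁ refl) (inj₁ refl) C C-avoids C-odd =
    contradiction (trans (sym (avoiding-closed-walk-even C C-avoids)) C-odd) λ ()
  no-odd-avoiding-walk-between-endpoints Y Y-odd (inj₂ refl) (inj₂ refl) C C-avoids C-odd =
    contradiction (trans (sym (avoiding-closed-walk-even C C-avoids)) C-odd) λ ()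

toParity : Fin 2 → Parity
toParity 0F        = 0ℙ
toParity (sucF 0F) = 1ℙ

toParity-≢ : ∀ {a b : Fin 2} → a ≢ b → toParity b ≡ toParity a ⁻¹
toParity-≢ {0F}      {0F}      a≢b = contradiction refl a≢b
toParity-≢ {0F}      {sucF 0F} _   = refl
toParity-≢ {sucF 0F} {0F}      _   = refl
toParity-≢ {sucF 0F} {sucF 0F} a≢b = contradiction refl a≢b

module ProperColouring {n : ℕ} {G : Graph n} (c : Colouring G) where
  open Graph G
  open Colouring c
  open Walks G

  -- The value at the empty walk is irrelevant.
  firstColour : ∀ {s t} → Walk G s t → Fin 2
  firstColour []               = 0F
  firstColour (step {u} v _ _) = col u v

  pivotColour : ∀ {w} → Pivot G c w → Parity
  pivotColour (W , _) = toParity (firstColour W)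

  properlyColoured-tail : ∀ {u v t} {uv : adj u v ≡ true} (W : Walk G v t) → ProperlyColoured G c (step v uv W) → ProperlyColoured G c W
  properlyColoured-tail []            _        = tt
  properlyColoured-tail (step _ _ _) (_ , pc) = pc

  firstColour-flips : ∀ {s m t} {sm : adj s m ≡ true} (W : Walk G m t) → 0 < length G W →
                      ProperlyColoured G c (step m sm W) → toParity (firstColour W) ≡ toParity (col s m) ⁻¹
  firstColour-flips (step _ _ _) _ (col≢ , _) = toParity-≢ col≢

  colour-alternates : ∀ {s t u v} (A : Walk G s u) {uv : adj u v ≡ true} (B : Walk G v t) →
    ProperlyColoured G c (A ++ step v uv B) →
    toParity (col u v) ≡ toParity (firstColour (A ++ step v uv B)) ⊕ parity (length G A)
  colour-alternates []                 B pc = sym (ℙ.+-identityʳ _)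
  colour-alternates {s} {u = u} {v} (step m sm A) B pc = begin
    toParity (col u v)                                                  ≡⟨ colour-alternates A B (properlyColoured-tail (A ++ _) pc) ⟩
    toParity (firstColour (A ++ step v _ B)) ⊕ parity (length G A)      ≡⟨ cong (_⊕ parity (length G A)) (firstColour-flips (A ++ step v _ B) rest-nonempty pc) ⟩
    (1ℙ ⊕ toParity (col s m)) ⊕ parity (length G A)                     ≡⟨ xy∙z≈y∙xz 1ℙ (toParity (col s m)) _ ⟩
    toParity (col s m) ⊕ (1ℙ ⊕ parity (length G A))                     ≡⟨ cong (toParity (col s m) ⊕_) (ℙ.+-homo-+ 1 (length G A)) ⟨
    toParity (col s m) ⊕ parity (suc (length G A))                      ∎
    where
    open ≡-Reasoning
    rest-nonempty : 0 < length G (A ++ step v _ B)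
    rest-nonempty = subst (0 <_) (sym (length-++ A (step v _ B))) (≤-trans (s≤s z≤n) (m≤n+m _ (length G A)))

  colour-SameEdge : ∀ {x y u v} → SameEdge x y u v → col u v ≡ col x y
  colour-SameEdge (inj₁ (refl , refl)) = refl
  colour-SameEdge (inj₂ (refl , refl)) = col-sym _ _

module StubbornEdgeColouring {n : ℕ} {G : Graph n} (c : Colouring G) {x y : Fin n} (stubborn : Stubborn G x y) where
  open Graph G
  open Colouring c
  open Walks G
  open StubbornEdge stubborn
  open ProperColouring c

  -- Two traversals of xy have the same colour, so the walk between them has odd length.
  no-second-traversal : ∀ {s u v t} (Y : Walk G s s) → parity (length G Y) ≡ 1ℙ → SameEdge x y u v →
    {uv : adj u v ≡ true} (R : Walk G v t) → ProperlyColoured G c (step v uv R) → traversals x y R ≡ 0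
  no-second-traversal {u = u} {v} Y Y-odd e {uv} R pc = n≤0⇒n≡0 (≮⇒≥ λ pos → impossible (first-traversal x y R pos))
    where
    impossible : FirstTraversal x y R → ⊥
    impossible (firstTraversal C _ D e′ C-avoids refl) =
      no-odd-avoiding-walk-between-endpoints Y Y-odd (target-Endpoint e) (source-Endpoint e′) C C-avoids C-odd
      where
      same-colour : toParity (col u v) ⊕ parity (suc (length G C)) ≡ toParity (col u v) ⊕ 0ℙ
      same-colour = begin
        toParity (col u v) ⊕ parity (suc (length G C)) ≡⟨ colour-alternates (step v uv C) D pc ⟨
        toParity (col _ _)                             ≡⟨ cong toParity (trans (colour-SameEdge e′) (sym (colour-SameEdge e))) ⟩
        toParity (col u v)                             ≡⟨ ℙ.+-identityʳ _ ⟨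
        toParity (col u v) ⊕ 0ℙ                        ∎
        where open ≡-Reasoning
      C-odd : parity (length G C) ≡ 1ℙ
      C-odd = trans (sym (ℙ.suc-homo-⁻¹ (length G C))) (cong _⁻¹ (ℙ.+-cancelˡ-≡ (toParity (col u v)) _ _ same-colour))

  traverses-at-most-once : ∀ {s a b} (Y : Walk G s s) → parity (length G Y) ≡ 1ℙ →
                           (W : Walk G a b) → ProperlyColoured G c W → traversals x y W ≤ 1
  traverses-at-most-once Y Y-odd []                _  = z≤n
  traverses-at-most-once Y Y-odd (step {u} v uv R) pc with sameEdge? x y u v
  ... | yes e = s≤s (≤-reflexive (no-second-traversal Y Y-odd e R pc))
  ... | no  _ = traverses-at-most-once Y Y-odd R (properlyColoured-tail R pc)

  pivot⇒even-bypass : ∀ {w} → Pivot G c w → Bypass 0ℙ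
  pivot⇒even-bypass {w} (W , W-odd , pc) with first-traversal x y W (EdgeIn⇒traversals>0 x y W (proj₂ stubborn w W W-odd))
  ... | firstTraversal {v = v} A uv B e _ refl = orient e (B ++ A) BA-avoids BA-even
    where
    W-parity : parity (length G (A ++ step v uv B)) ≡ 1ℙ
    W-parity = %2≡1⇒parity≡1ℙ (length G (A ++ step v uv B)) W-odd
    avoids : traversals x y A ≡ 0 × traversals x y B ≡ 0
    avoids = traversals≤1⇒avoids-around x y A B e (traverses-at-most-once (A ++ step v uv B) W-parity (A ++ step v uv B) pc)
    BA-avoids : traversals x y (B ++ A) ≡ 0
    BA-avoids = trans (traversals-++ x y B A) (cong₂ _+_ (proj₂ avoids) (proj₁ avoids))
    BA-even : parity (length G (B ++ A)) ≡ 0ℙ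
    BA-even = begin
      parity (length G (B ++ A))              ≡⟨ cong parity (trans (length-++ B A) (+-comm (length G B) _)) ⟩
      parity (length G A + length G B)        ≡⟨ ℙ.suc-homo-⁻¹ (length G A + length G B) ⟨
      parity (suc (length G A + length G B)) ⁻¹ ≡⟨ cong (λ k → parity k ⁻¹) (trans (length-++ A _) (+-suc (length G A) (length G B))) ⟨
      parity (length G (A ++ step v uv B)) ⁻¹ ≡⟨ cong _⁻¹ W-parity ⟩
      0ℙ                                      ∎
      where open ≡-Reasoning
    orient : ∀ {u v} → SameEdge x y u v → (C : Walk G v u) → traversals x y C ≡ 0 → parity (length G C) ≡ 0ℙ → Bypass 0ℙ
    orient (inj₁ (refl , refl)) C C-avoids C-even =
      reverse C , trans (traversals-reverse x y C) C-avoids , trans (cong parity (length-reverse C)) C-even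
    orient (inj₂ (refl , refl)) C C-avoids C-even = C , C-avoids , C-even

  record Approach {w} (pw : Pivot G c w) : Set where
    field
      {u v}  : Fin n
      walk   : Walk G w u
      same   : SameEdge x y u v
      colour : toParity (col x y) ≡ pivotColour pw ⊕ offEdgeParity x y walk

  approach : ∀ {w} (pw : Pivot G c w) → Approach pw
  approach {w} pw@(W , W-odd , pc) with first-traversal x y W (EdgeIn⇒traversals>0 x y W (proj₂ stubborn w W W-odd))
  ... | firstTraversal A _ B e A-avoids refl = record { walk = A ; same = e ; colour = begin
    toParity (col x y)                                  ≡⟨ cong toParity (colour-SameEdge e) ⟨
    toParity (col _ _)                                  ≡⟨ colour-alternates A B pc ⟩
    pivotColour pw ⊕ parity (length G A)                ≡⟨ cong (pivotColour pw ⊕_) (ℙ.+-identityʳ _) ⟨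
    pivotColour pw ⊕ (parity (length G A) ⊕ 0ℙ)         ≡⟨ cong (λ k → pivotColour pw ⊕ (parity (length G A) ⊕ parity k)) A-avoids ⟨
    pivotColour pw ⊕ offEdgeParity x y A                ∎ }
    where open ≡-Reasoning

  link : ∀ {u₁ v₁ u₂ v₂} → SameEdge x y u₁ v₁ → SameEdge x y u₂ v₂ → Σ (Walk G u₁ u₂) λ L → offEdgeParity x y L ≡ 0ℙ
  link (inj₁ (refl , refl)) (inj₁ (refl , refl)) = [] , refl
  link (inj₂ (refl , refl)) (inj₂ (refl , refl)) = [] , refl
  link (inj₁ (refl , refl)) (inj₂ (refl , refl)) =
    step y (proj₁ stubborn) [] , cong (λ k → 1ℙ ⊕ parity (k + 0)) (traversal-≡1 {x = x} {y} (inj₁ (refl , refl)))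
  link (inj₂ (refl , refl)) (inj₁ (refl , refl)) =
    step x (adj-reverse (proj₁ stubborn)) [] , cong (λ k → 1ℙ ⊕ parity (k + 0)) (traversal-≡1 {x = x} {y} (inj₂ (refl , refl)))

  -- Close P up through the edge xy: the closed walk has an even number of steps off xy,
  -- and the parities of the two approaches are fixed by the colour of xy.
  offEdgeParity-between-pivots : ∀ {u v} (pu : Pivot G c u) (pv : Pivot G c v) (P : Walk G u v) →
    offEdgeParity x y P ≡ pivotColour pu ⊕ pivotColour pv
  offEdgeParity-between-pivots pu pv P = begin
    offEdgeParity x y P ≡⟨ x∙y⁻¹≈ε⇒x≈y (a ⊕ b) _ closed ⟨
    a ⊕ b               ≡⟨ x∙y⁻¹≈ε⇒x≈y (pivotColour pu ⊕ pivotColour pv) _ colours ⟨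
    pivotColour pu ⊕ pivotColour pv ∎
    where
    open ≡-Reasoning
    module U = Approach (approach pu)
    module V = Approach (approach pv)
    a b : Parity
    a = offEdgeParity x y U.walk
    b = offEdgeParity x y V.walk
    L : Walk G U.u V.u
    L = proj₁ (link U.same V.same)
    colours : (pivotColour pu ⊕ pivotColour pv) ⊕ (a ⊕ b) ≡ 0ℙ
    colours = begin
      (pivotColour pu ⊕ pivotColour pv) ⊕ (a ⊕ b) ≡⟨ interchange (pivotColour pu) _ _ _ ⟩
      (pivotColour pu ⊕ a) ⊕ (pivotColour pv ⊕ b) ≡⟨ cong₂ _⊕_ U.colour V.colour ⟨
      toParity (col x y) ⊕ toParity (col x y)      ≡⟨ ℙ.p+p≡0ℙ (toParity (col x y)) ⟩
      0ℙ                                           ∎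
    closed : (a ⊕ b) ⊕ offEdgeParity x y P ≡ 0ℙ
    closed = begin
      (a ⊕ b) ⊕ offEdgeParity x y P ≡⟨ ℙ.+-assoc a _ _ ⟩
      a ⊕ (0ℙ ⊕ (b ⊕ offEdgeParity x y P))
        ≡⟨ cong₂ (λ l r → a ⊕ (l ⊕ r)) (proj₂ (link U.same V.same))
                 (cong₂ _⊕_ (offEdgeParity-reverse x y V.walk) (offEdgeParity-reverse x y P)) ⟨
      a ⊕ (offEdgeParity x y L ⊕ (offEdgeParity x y (reverse V.walk) ⊕ offEdgeParity x y (reverse P)))
        ≡⟨ cong (a ⊕_) (trans (offEdgeParity-++ x y L _) (cong (offEdgeParity x y L ⊕_) (offEdgeParity-++ x y (reverse V.walk) _))) ⟨
      a ⊕ offEdgeParity x y (L ++ reverse V.walk ++ reverse P) ≡⟨ offEdgeParity-++ x y U.walk _ ⟨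
      offEdgeParity x y (U.walk ++ L ++ reverse V.walk ++ reverse P)
        ≡⟨ offEdgeParity-closed (pivot⇒even-bypass pu) (U.walk ++ L ++ reverse V.walk ++ reverse P) ⟩
      0ℙ ∎

fromParity : Parity → Fin 2
fromParity 0ℙ = 0F
fromParity 1ℙ = sucF 0F

Fin2↔Parity : Fin 2 ↔ Parity
Fin2↔Parity = mk↔ₛ′ toParity fromParity to-from from-to
  where
  to-from : ∀ p → toParity (fromParity p) ≡ p
  to-from 0ℙ = refl
  to-from 1ℙ = refl
  from-to : ∀ i → fromParity (toParity i) ≡ i
  from-to 0F        = refl
  from-to (sucF 0F) = refl

⊕-parity-suc : ∀ p m → p ⊕ parity (suc m) ≡ p ⁻¹ ⊕ parity m
⊕-parity-suc p m = begin
  p ⊕ parity (suc m)      ≡⟨ cong (p ⊕_) (ℙ.+-homo-+ 1 m) ⟩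
  p ⊕ (1ℙ ⊕ parity m)     ≡⟨ ℙ.+-assoc p 1ℙ (parity m) ⟨
  (p ⊕ 1ℙ) ⊕ parity m     ≡⟨ cong (_⊕ parity m) (ℙ.+-comm p 1ℙ) ⟩
  p ⁻¹ ⊕ parity m         ∎
  where open ≡-Reasoning

module Decidability {n : ℕ} (G : Graph n) where
  open Graph G
  open Walks G

  -- Steps of the graph doubled by length parity, deleting the edge xy.
  AvoidingStep : Fin n → Fin n → Rel (Fin n × Parity) 0ℓ
  AvoidingStep x y (a , p) (b , q) = adj a b ≡ true × ¬ SameEdge x y a b × q ≡ p ⁻¹

  avoidingStep? : ∀ x y → Decidable (AvoidingStep x y)
  avoidingStep? x y (a , p) (b , q) = adj a b Bool.≟ true ×-dec ¬? (sameEdge? x y a b) ×-dec q ℙ.≟ p ⁻¹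

  Star⇒avoiding-walk : ∀ {x y a b p q} → Star (AvoidingStep x y) (a , p) (b , q) →
                       Σ (Walk G a b) λ W → traversals x y W ≡ 0 × p ⊕ parity (length G W) ≡ q
  Star⇒avoiding-walk {p = p} ε = [] , refl , ℙ.+-identityʳ p
  Star⇒avoiding-walk {p = p} ((ab , ¬e , refl) ◅ rest) with Star⇒avoiding-walk rest
  ... | W , avoids , parity≡ = step _ ab W , trans (cong (_+ _) (traversal-≡0 ¬e)) avoids , trans (⊕-parity-suc p (length G W)) parity≡

  avoiding-walk⇒Star : ∀ {x y a b} p (W : Walk G a b) → traversals x y W ≡ 0 →
                       Star (AvoidingStep x y) (a , p) (b , p ⊕ parity (length G W))
  avoiding-walk⇒Star {a = a} p [] _ = subst (λ q → Star _ (a , p) (a , q)) (sym (ℙ.+-identityʳ p)) ε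
  avoiding-walk⇒Star {x} {y} {a} {b} p (step v uv W) avoids =
    (uv , ¬e , refl) ◅ subst (λ q → Star _ (v , p ⁻¹) (b , q)) (sym (⊕-parity-suc p (length G W)))
                             (avoiding-walk⇒Star (p ⁻¹) W (m+n≡0⇒n≡0 (traversal x y a v) avoids))
    where
    ¬e : ¬ SameEdge x y a v
    ¬e e = contradiction (trans (sym (traversal-≡1 e)) (m+n≡0⇒m≡0 _ avoids)) λ ()

  OddAvoidingClosedWalk : Fin n → Fin n → Set
  OddAvoidingClosedWalk x y = ∃ λ w → Σ (Walk G w w) λ W → traversals x y W ≡ 0 × parity (length G W) ≡ 1ℙ

  oddAvoidingClosedWalk? : ∀ x y → Dec (OddAvoidingClosedWalk x y)
  oddAvoidingClosedWalk? x y = map′ (λ (w , st) → w , Star⇒avoiding-walk st) from-walk (any? λ w → star? (w , 0ℙ) (w , 1ℙ))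
    where
    enum : (Fin n × Parity) ↔ Fin (n * 2)
    enum = ↔-trans (↔-refl ×-↔ ↔-sym Fin2↔Parity) (↔-sym *↔×)
    star? : ∀ s t → Dec (Star (AvoidingStep x y) s t)
    star? = FiniteReachability.star? enum (avoidingStep? x y)
    from-walk : OddAvoidingClosedWalk x y → ∃ λ w → Star (AvoidingStep x y) (w , 0ℙ) (w , 1ℙ)
    from-walk (w , W , avoids , odd) = w , subst (λ q → Star _ (w , 0ℙ) (w , q)) odd (avoiding-walk⇒Star 0ℙ W avoids)

  stubborn? : ∀ x y → Dec (Stubborn G x y)
  stubborn? x y with adj x y Bool.≟ true | oddAvoidingClosedWalk? x y
  ... | no ¬xy | _ = no (¬xy ∘ proj₁)
  ... | yes _  | yes (w , W , avoids , odd) = no λ (_ , st) →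
    contradiction (subst (0 <_) avoids (EdgeIn⇒traversals>0 x y W (st w W (parity≡1ℙ⇒%2≡1 (length G W) odd)))) λ ()
  ... | yes xy | no none = yes (xy , λ w W odd →
    traversals>0⇒EdgeIn x y W (n≢0⇒n>0 λ avoids → none (w , W , avoids , %2≡1⇒parity≡1ℙ (length G W) odd)))

  NonStubbornStep : Rel (Fin n) 0ℓ
  NonStubbornStep a b = adj a b ≡ true × ¬ Stubborn G a b

  Star⇒SameSFreeComponent : ∀ {u v} → Star NonStubbornStep u v → SameSFreeComponent G u v
  Star⇒SameSFreeComponent ε                  = [] , tt
  Star⇒SameSFreeComponent ((ab , ¬st) ◅ rest) with Star⇒SameSFreeComponent rest
  ... | W , avoids = step _ ab W , ¬st , avoids

  SameSFreeComponent⇒Star : ∀ {u v} → SameSFreeComponent G u v → Star NonStubbornStep u v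
  SameSFreeComponent⇒Star ([]           , _)            = ε
  SameSFreeComponent⇒Star (step _ ab W , ¬st , avoids) = (ab , ¬st) ◅ SameSFreeComponent⇒Star (W , avoids)

  sameSFreeComponent? : ∀ u v → Dec (SameSFreeComponent G u v)
  sameSFreeComponent? u v =
    map′ Star⇒SameSFreeComponent SameSFreeComponent⇒Star
         (FiniteReachability.star? ↔-refl (λ a b → adj a b Bool.≟ true ×-dec ¬? (stubborn? a b)) u v)

module PivotComponents {n : ℕ} {G : Graph n} (c : Colouring G) where
  open Graph G
  open Walks G
  open Decidability G
  open ProperColouring c
  open StubbornEdgeColouring c using (offEdgeParity-between-pivots; traverses-at-most-once)

  traversal-parities-agree : ∀ {x y x′ y′ u v} → Stubborn G x y → Stubborn G x′ y′ →
    Pivot G c u → Pivot G c v → (P : Walk G u v) → parity (traversals x y P) ≡ parity (traversals x′ y′ P)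
  traversal-parities-agree f g pu pv P = ℙ.+-cancelˡ-≡ (parity (length G P)) _ _
    (trans (offEdgeParity-between-pivots f pu pv P) (sym (offEdgeParity-between-pivots g pu pv P)))

  boundary-stubborn : ∀ {u a b} → SameSFreeComponent G u a → ¬ SameSFreeComponent G u b → adj a b ≡ true → Stubborn G a b
  boundary-stubborn {a = a} {b} (W , avoids) ¬u~b ab with stubborn? a b
  ... | yes st  = st
  ... | no  ¬st = contradiction (W ++ step b ab [] , AvoidsStubborn-++ W _ avoids (¬st , tt)) ¬u~b

  -- The pivot walk at v traverses f = b₀a and later g = a′b′ once each; continuing from u to a′
  -- inside the component and then along the rest of the walk traverses g once and f never.
  no-reentry-through-stubborn : ∀ {u v a b₀ a′ b′} → Pivot G c u → (pv : Pivot G c v) →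
    Stubborn G a b₀ → Stubborn G a′ b′ → SameSFreeComponent G u a′ →
    (A : Walk G v b₀) {b₀a : adj b₀ a ≡ true} (M : Walk G a a′) {a′b′ : adj a′ b′ ≡ true} (D : Walk G b′ v) →
    proj₁ pv ≡ A ++ step a b₀a (M ++ step b′ a′b′ D) → ⊥
  no-reentry-through-stubborn {u} {v} {a} {b₀} {a′} {b′} pu pv@(Wv , Wv-odd , Wv-pc) f g (Q , Q-avoids) A {b₀a} M {a′b′} D refl =
    contradiction (traversal-parities-agree f g pu pv P)
                  (subst₂ (λ i j → parity i ≢ parity j) (sym P-avoids-f) (sym P-traverses-g) λ ())
    where
    Wv-parity : parity (length G Wv) ≡ 1ℙ
    Wv-parity = %2≡1⇒parity≡1ℙ (length G Wv) Wv-odd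
    f-rest : traversals a b₀ (M ++ step b′ a′b′ D) ≡ 0
    f-rest = proj₂ (traversals≤1⇒avoids-around a b₀ A _ (inj₂ (refl , refl))
                      (traverses-at-most-once f Wv Wv-parity Wv Wv-pc))
    g-rest : traversals a′ b′ D ≡ 0
    g-rest = proj₂ (traversals≤1⇒avoids-around a′ b′ (A ++ step a b₀a M) D (inj₁ (refl , refl))
               (subst (λ W → traversals a′ b′ W ≤ 1) (sym (++-assoc A (step a b₀a M) _))
                      (traverses-at-most-once g Wv Wv-parity Wv Wv-pc)))
    P : Walk G u v
    P = Q ++ step b′ a′b′ D
    P-avoids-f : traversals a b₀ P ≡ 0
    P-avoids-f = trans (traversals-++ a b₀ Q _)
      (cong₂ _+_ (AvoidsStubborn⇒traversals≡0 f Q Q-avoids)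
                 (m+n≡0⇒n≡0 (traversals a b₀ M) (trans (sym (traversals-++ a b₀ M _)) f-rest)))
    P-traverses-g : traversals a′ b′ P ≡ 1
    P-traverses-g = trans (traversals-++ a′ b′ Q _)
      (cong₂ _+_ (AvoidsStubborn⇒traversals≡0 g Q Q-avoids) (cong₂ _+_ (traversal-≡1 (inj₁ (refl , refl))) g-rest))

  pivots-in-one-component : Connected G → ∀ {u v} → Pivot G c u → Pivot G c v → ¬ ¬ SameSFreeComponent G u v
  pivots-in-one-component conn {u} {v} pu pv@(Wv , Wv-odd , _) ¬u~v =
    reentry (EdgeIn⇒split Exit.a Exit.b Wv (proj₂ exit-stubborn v Wv Wv-odd))
    where
    C? : Decidable₁ (SameSFreeComponent G u)
    C? = sameSFreeComponent? u
    module Exit = Crossing (crossing C? ([] , tt) ¬u~v (conn u v))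
    exit-stubborn : Stubborn G Exit.a Exit.b
    exit-stubborn = boundary-stubborn Exit.inside Exit.outside Exit.edge
    reentry : (∃₂ λ W₁ W₂ → Wv ≡ W₁ ++ W₂) → ⊥
    reentry (W₁ , W₂ , Wv≡) =
      no-reentry-through-stubborn pu pv f g Leave.inside Enter.before Leave.before Leave.after split
      where
      module Enter = Crossing (crossing (¬? ∘ C?) ¬u~v (λ ¬u~hx → ¬u~hx Exit.inside) W₁)
      u~a : SameSFreeComponent G u Enter.b
      u~a = decidable-stable (C? Enter.b) Enter.outside
      module Leave = Crossing (crossing C? u~a ¬u~v (Enter.after ++ W₂))
      f : Stubborn G Enter.b Enter.a
      f = boundary-stubborn u~a Enter.inside (adj-reverse Enter.edge)
      g : Stubborn G Leave.a Leave.b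
      g = boundary-stubborn Leave.inside Leave.outside Leave.edge
      split : Wv ≡ Enter.before ++ step Enter.b Enter.edge (Leave.before ++ step Leave.b Leave.edge Leave.after)
      split = begin
        Wv                                                            ≡⟨ Wv≡ ⟩
        W₁ ++ W₂                                                      ≡⟨ cong (_++ W₂) Enter.decomposition ⟩
        (Enter.before ++ step Enter.b Enter.edge Enter.after) ++ W₂   ≡⟨ ++-assoc Enter.before _ W₂ ⟩
        Enter.before ++ step Enter.b Enter.edge (Enter.after ++ W₂)   ≡⟨ cong (λ R → Enter.before ++ step Enter.b Enter.edge R) Leave.decomposition ⟩
        Enter.before ++ step Enter.b Enter.edge (Leave.before ++ step Leave.b Leave.edge Leave.after) ∎
        where open ≡-Reasoning

proposition6 : (n : ℕ) (G : Graph n) (c : Colouring G) → Connected G →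
    (u v : Fin n) → Pivot G c u → Pivot G c v → SameSFreeComponent G u v
proposition6 n G c conn u v pu pv =
  decidable-stable (Decidability.sameSFreeComponent? G u v) (PivotComponents.pivots-in-one-component c conn pu pv)
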